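{- For positive integers $a,b$ let $N(a,b)=\frac{1}{a}\binom{a}{b}\binom{a}{b-1}$. Let $a$ be a positive integer and let $p$ be the largest prime with $p<a$. Suppose $b$ is an integer with $a/2\geq b>a-p+1$. If $N(a,b)=m^k$ for some positive integers $m$ and $k$, then $k\leq 2$.
   Context: $N(a,b)$ is the Narayana number. -}

module Defs where

open import Data.Nat using (ℕ; NonZero; _*_; _∸_; _/_)
open import Data.Nat.Combinatorics using (_C_)

-- Narayana number N(a,b) = (1/a) * binom(a,b) * binom(a,b-1), for positive a.
-- The division is exact for a ≥ 1, b ≥ 1.
N : (a b : ℕ) → .{{NonZero a}} → ℕ
N a b = ((a C b) * (a C (b ∸ 1))) / a

-- Write b = c + 1. The hypotheses force b < p ≤ a < 2p, so in each of
-- a! / (b! (a−b)!) and a! / (c! (a−c)!) the prime p divides the numerator exactly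
-- once and the denominator not at all: p divides both binomial coefficients exactly
-- once, and p² divides a·N(a,b) = C(a,b)·C(a,c) exactly. As p < a < 2p, p ∤ a, so
-- p ∣ N(a,b). If N(a,b) = m^k then p ∣ m, hence p^k ∣ N(a,b), impossible for k ≥ 3.
module Submission where

open import Defs
open import Data.Nat using (ℕ; NonZero; _+_; _*_; _^_; _≤_; _<_)
open import Data.Nat.Primality using (Prime)
open import Relation.Binary.PropositionalEquality using (_≡_)

open import Data.Nat.Base using (zero; suc; _!; _∸_; z≤n; s≤s; z<s; s<s⁻¹; >-nonZero)
open import Data.Nat.Properties
open import Data.Nat.Divisibility
open import Data.Nat.DivMod using (m/n*n≡m; m*[n/m]≡n)
open import Data.Nat.Combinatorics using (_C_; nCk≡n!/k![n-k]!; k![n∸k]!∣n!; nCk≡nC[n∸k])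
open import Data.Nat.Primality using (euclidsLemma; prime⇒nonZero; ¬prime[1])
open import Data.Nat.Tactic.RingSolver using (solve-∀)
open import Data.Product using (Σ-syntax; _,_; _×_)
open import Data.Sum using (inj₁; inj₂)
open import Relation.Nullary using (contradiction)
open import Relation.Binary.PropositionalEquality using (refl; sym; trans; cong; cong₂; subst; subst₂; module ≡-Reasoning)

prime∤1 : ∀ {p} → Prime p → p ∤ 1
prime∤1 pp p∣1 = ¬prime[1] (subst Prime (∣1⇒≡1 p∣1) pp)

prime∤m*n : ∀ {p m n} → Prime p → p ∤ m → p ∤ n → p ∤ m * n
prime∤m*n {m = m} {n} pp p∤m p∤n p∣m*n with euclidsLemma m n pp p∣m*n
... | inj₁ p∣m = p∤m p∣m
... | inj₂ p∣n = p∤n p∣n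

prime∣m^k⇒∣m : ∀ {p} m k → Prime p → p ∣ m ^ k → p ∣ m
prime∣m^k⇒∣m m zero    pp p∣1 = contradiction p∣1 (prime∤1 pp)
prime∣m^k⇒∣m m (suc k) pp p∣m^[1+k] with euclidsLemma m (m ^ k) pp p∣m^[1+k]
... | inj₁ p∣m   = p∣m
... | inj₂ p∣m^k = prime∣m^k⇒∣m m k pp p∣m^k

∣⇒^∣^ : ∀ {d m} k → d ∣ m → d ^ k ∣ m ^ k
∣⇒^∣^ zero    _   = ∣-refl
∣⇒^∣^ (suc k) d∣m = *-pres-∣ d∣m (∣⇒^∣^ k d∣m)

p<n<p+p⇒p∤n : ∀ {p n} → p < n → n < p + p → p ∤ n
p<n<p+p⇒p∤n {suc p} {n} p<n n<p+p p∣n =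
  >⇒∤ {{>-nonZero (m<n⇒0<n∸m p<n)}} (m<n+o⇒m∸n<o n (suc p) n<p+p) p∣n∸p
  where
  p∣n∸p : suc p ∣ n ∸ suc p
  p∣n∸p = ∣m+n∣m⇒∣n (subst (suc p ∣_) (sym (m+[n∸m]≡n (<⇒≤ p<n))) p∣n) ∣-refl

prime∤n! : ∀ {p} n → Prime p → n < p → p ∤ n !
prime∤n! zero    pp _   = prime∤1 pp
prime∤n! (suc n) pp n<p = prime∤m*n pp (>⇒∤ n<p) (prime∤n! n pp (<-trans (n<1+n n) n<p))

infix 4 _∥_
_∥_ : ℕ → ℕ → Set
p ∥ n = Σ[ u ∈ ℕ ] n ≡ p * u × p ∤ u

∥⇒∣ : ∀ {p n} → p ∥ n → p ∣ n
∥⇒∣ (u , n≡p*u , _) = subst (_ ∣_) (sym n≡p*u) (m∣m*n u)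

∤∧∥⇒∥* : ∀ {p m n} → Prime p → p ∤ m → p ∥ n → p ∥ m * n
∤∧∥⇒∥* {p} {m} {n} pp p∤m (u , n≡p*u , p∤u) = m * u , m*n≡p*[m*u] , prime∤m*n pp p∤m p∤u
  where
  x*[y*z]≡y*[x*z] : ∀ x y z → x * (y * z) ≡ y * (x * z)
  x*[y*z]≡y*[x*z] = solve-∀
  m*n≡p*[m*u] : m * n ≡ p * (m * u)
  m*n≡p*[m*u] = trans (cong (m *_) n≡p*u) (x*[y*z]≡y*[x*z] m p u)

∥*∧∤⇒∥ : ∀ {p m n} → Prime p → p ∤ n → p ∥ m * n → p ∥ m
∥*∧∤⇒∥ {p} {m} {n} pp p∤n p∥m*n@(w , m*n≡p*w , p∤w) with euclidsLemma m n pp (∥⇒∣ p∥m*n)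
... | inj₂ p∣n = contradiction p∣n p∤n
... | inj₁ (divides u m≡u*p) = u , m≡p*u , p∤u
  where
  open ≡-Reasoning
  m≡p*u : m ≡ p * u
  m≡p*u = trans m≡u*p (*-comm u p)
  u*n≡w : u * n ≡ w
  u*n≡w = *-cancelˡ-≡ (u * n) w p {{prime⇒nonZero pp}} (begin
    p * (u * n) ≡⟨ *-assoc p u n ⟨
    p * u * n   ≡⟨ cong (_* n) m≡p*u ⟨
    m * n       ≡⟨ m*n≡p*w ⟩
    p * w       ∎)
  p∤u : p ∤ u
  p∤u p∣u = p∤w (subst (p ∣_) u*n≡w (∣m⇒∣m*n n p∣u))

∥∧∥⇒^3∤* : ∀ {p x y} → Prime p → p ∥ x → p ∥ y → p ^ 3 ∤ x * y
∥∧∥⇒^3∤* {p} {x} {y} pp (u , x≡p*u , p∤u) (v , y≡p*v , p∤v) p^3∣x*y =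
  prime∤m*n pp p∤u p∤v (*-cancelˡ-∣ (p * p) {{m*n≢0 p p}} p*p*p∣p*p*[u*v])
  where
  instance _ = prime⇒nonZero pp
  cube : ∀ x → x * (x * (x * 1)) ≡ x * x * x
  cube = solve-∀
  x*y≡p*p*[u*v] : x * y ≡ p * p * (u * v)
  x*y≡p*p*[u*v] = trans (cong₂ _*_ x≡p*u y≡p*v) (rearrange p u v)
    where
    rearrange : ∀ p u v → p * u * (p * v) ≡ p * p * (u * v)
    rearrange = solve-∀
  p*p*p∣p*p*[u*v] : p * p * p ∣ p * p * (u * v)
  p*p*p∣p*p*[u*v] = subst₂ _∣_ (cube p) x*y≡p*p*[u*v] p^3∣x*y

prime∥[p+d]! : ∀ {p} d → Prime p → d < p → p ∥ (p + d) !
prime∥[p+d]! {suc q} zero    pp _     = q ! , cong _! (+-identityʳ (suc q)) , prime∤n! q pp ≤-refl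
prime∥[p+d]! {p}     (suc d) pp 1+d<p =
  subst (λ n → p ∥ n !) (sym (+-suc p d))
        (∤∧∥⇒∥* pp p∤[p+d+1] (prime∥[p+d]! d pp (<-trans (n<1+n d) 1+d<p)))
  where
  p∤[p+d+1] : p ∤ suc (p + d)
  p∤[p+d+1] = p<n<p+p⇒p∤n (s≤s (m≤m+n p d)) (subst (_< p + p) (+-suc p d) (+-monoʳ-< p 1+d<p))

prime∥n! : ∀ {p n} → Prime p → p ≤ n → n < p + p → p ∥ n !
prime∥n! {p} {n} pp p≤n n<p+p =
  subst (λ n → p ∥ n !) (m+[n∸m]≡n p≤n)
        (prime∥[p+d]! (n ∸ p) pp (m<n+o⇒m∸n<o n p {{prime⇒nonZero pp}} n<p+p))

nCk*k![n∸k]!≡n! : ∀ {n k} → k ≤ n → (n C k) * (k ! * (n ∸ k) !) ≡ n !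
nCk*k![n∸k]!≡n! {n} {k} k≤n =
  trans (cong (_* (k ! * (n ∸ k) !)) (nCk≡n!/k![n-k]! k≤n)) (m/n*n≡m (k![n∸k]!∣n! k≤n))
  where instance _ = k !* (n ∸ k) !≢0

prime∥nCk : ∀ {p n k} → Prime p → k ≤ n → k < p → n ∸ k < p → p ≤ n → n < p + p → p ∥ n C k
prime∥nCk {p} {n} {k} pp k≤n k<p n∸k<p p≤n n<p+p =
  ∥*∧∤⇒∥ pp (prime∤m*n pp (prime∤n! k pp k<p) (prime∤n! (n ∸ k) pp n∸k<p))
         (subst (p ∥_) (sym (nCk*k![n∸k]!≡n! k≤n)) (prime∥n! pp p≤n n<p+p))

[1+k]*[1+n]C[1+k]≡[1+n]*nCk : ∀ {n k} → k ≤ n → suc k * (suc n C suc k) ≡ suc n * (n C k)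
[1+k]*[1+n]C[1+k]≡[1+n]*nCk {n} {k} k≤n = *-cancelʳ-≡ _ _ (k ! * (n ∸ k) !) {{k !* (n ∸ k) !≢0}} (begin
  suc k * (suc n C suc k) * (k ! * (n ∸ k) !) ≡⟨ rearrange (suc k) (suc n C suc k) (k !) ((n ∸ k) !) ⟩
  (suc n C suc k) * (suc k ! * (n ∸ k) !)     ≡⟨ nCk*k![n∸k]!≡n! (s≤s k≤n) ⟩
  suc n * n !                                 ≡⟨ cong (suc n *_) (nCk*k![n∸k]!≡n! k≤n) ⟨
  suc n * ((n C k) * (k ! * (n ∸ k) !))       ≡⟨ *-assoc (suc n) (n C k) _ ⟨
  suc n * (n C k) * (k ! * (n ∸ k) !)         ∎)
  where
  open ≡-Reasoning
  rearrange : ∀ x y f g → x * y * (f * g) ≡ y * ((x * f) * g)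
  rearrange = solve-∀

[1+n∸k]*[1+n]Ck≡[1+n]*nCk : ∀ {n k} → k ≤ n → (suc n ∸ k) * (suc n C k) ≡ suc n * (n C k)
[1+n∸k]*[1+n]Ck≡[1+n]*nCk {n} {k} k≤n = begin
  (suc n ∸ k) * (suc n C k)               ≡⟨ cong ((suc n ∸ k) *_) (nCk≡nC[n∸k] (m≤n⇒m≤1+n k≤n)) ⟩
  (suc n ∸ k) * (suc n C (suc n ∸ k))     ≡⟨ cong (λ j → j * (suc n C j)) (+-∸-assoc 1 k≤n) ⟩
  suc (n ∸ k) * (suc n C suc (n ∸ k))     ≡⟨ [1+k]*[1+n]C[1+k]≡[1+n]*nCk (m∸n≤m n k) ⟩
  suc n * (n C (n ∸ k))                   ≡⟨ cong (suc n *_) (nCk≡nC[n∸k] k≤n) ⟨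
  suc n * (n C k)                         ∎
  where open ≡-Reasoning

-- For the product X, both X·(k+1) and X·(a−k) are multiples of a by absorption,
-- and they sum to X·(a+1).
a∣aC[1+k]*aCk : ∀ {n k} → k ≤ n → suc n ∣ (suc n C suc k) * (suc n C k)
a∣aC[1+k]*aCk {n} {k} k≤n = ∣m+n∣m⇒∣n (subst (suc n ∣_) X*[a+1]≡X*a+X a∣X*[a+1]) (n∣m*n X)
  where
  open ≡-Reasoning
  a = suc n
  X = (a C suc k) * (a C k)
  a∣X*[1+k] : a ∣ X * suc k
  a∣X*[1+k] = subst (a ∣_) (begin
    (a C k) * (a * (n C k))        ≡⟨ cong ((a C k) *_) ([1+k]*[1+n]C[1+k]≡[1+n]*nCk k≤n) ⟨
    (a C k) * (suc k * (a C suc k)) ≡⟨ rearrange (a C suc k) (a C k) (suc k) ⟨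
    X * suc k                      ∎) (∣n⇒∣m*n (a C k) (m∣m*n (n C k)))
    where
    rearrange : ∀ x y z → x * y * z ≡ y * (z * x)
    rearrange = solve-∀
  a∣X*[a∸k] : a ∣ X * (a ∸ k)
  a∣X*[a∸k] = subst (a ∣_) (begin
    (a C suc k) * (a * (n C k))       ≡⟨ cong ((a C suc k) *_) ([1+n∸k]*[1+n]Ck≡[1+n]*nCk k≤n) ⟨
    (a C suc k) * ((a ∸ k) * (a C k)) ≡⟨ rearrange (a C suc k) (a C k) (a ∸ k) ⟨
    X * (a ∸ k)                       ∎) (∣n⇒∣m*n (a C suc k) (m∣m*n (n C k)))
    where
    rearrange : ∀ x y z → x * y * z ≡ x * (z * y)
    rearrange = solve-∀
  a∣X*[a+1] : a ∣ X * suc k + X * (a ∸ k)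
  a∣X*[a+1] = ∣m∣n⇒∣m+n a∣X*[1+k] a∣X*[a∸k]
  X*[a+1]≡X*a+X : X * suc k + X * (a ∸ k) ≡ X * a + X
  X*[a+1]≡X*a+X = begin
    X * suc k + X * (a ∸ k) ≡⟨ *-distribˡ-+ X (suc k) (a ∸ k) ⟨
    X * suc (k + (a ∸ k))   ≡⟨ cong (λ j → X * suc j) (m+[n∸m]≡n (m≤n⇒m≤1+n k≤n)) ⟩
    X * suc a               ≡⟨ *-suc X a ⟩
    X + X * a               ≡⟨ +-comm X (X * a) ⟩
    X * a + X               ∎

a*N[a,1+k]≡aC[1+k]*aCk : ∀ {n k} → k ≤ n → suc n * N (suc n) (suc k) ≡ (suc n C suc k) * (suc n C k)
a*N[a,1+k]≡aC[1+k]*aCk k≤n = m*[n/m]≡n (a∣aC[1+k]*aCk k≤n)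

p∣a*m^k∧p^3∤a*m^k⇒k≤2 : ∀ {p a} m k → Prime p → p ∤ a → p ∣ a * m ^ k → p ^ 3 ∤ a * m ^ k → k ≤ 2
p∣a*m^k∧p^3∤a*m^k⇒k≤2 m zero                      _  _   _        _         = z≤n
p∣a*m^k∧p^3∤a*m^k⇒k≤2 m (suc zero)                _  _   _        _         = s≤s z≤n
p∣a*m^k∧p^3∤a*m^k⇒k≤2 m (suc (suc zero))          _  _   _        _         = s≤s (s≤s z≤n)
p∣a*m^k∧p^3∤a*m^k⇒k≤2 {p} {a} m k@(suc (suc (suc j))) pp p∤a p∣a*m^k p^3∤a*m^k =
  contradiction (∣n⇒∣m*n a p^3∣m^k) p^3∤a*m^k
  where
  p∣m : p ∣ m
  p∣m with euclidsLemma a (m ^ k) pp p∣a*m^k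
  ... | inj₁ p∣a   = contradiction p∣a p∤a
  ... | inj₂ p∣m^k = prime∣m^k⇒∣m m k pp p∣m^k
  p^3∣m^k : p ^ 3 ∣ m ^ k
  p^3∣m^k = subst (p ^ 3 ∣_) (sym (^-distribˡ-+-* m 3 j)) (∣m⇒∣m*n (m ^ j) (∣⇒^∣^ 3 p∣m))

2*b≤a∧a+1<b+p⇒b<p : ∀ {a b p} → 2 * b ≤ a → a + 1 < b + p → b < p
2*b≤a∧a+1<b+p⇒b<p {a} {b} {p} 2b≤a a+1<b+p = +-cancelˡ-< b b p (begin-strict
  b + b ≡⟨ cong (b +_) (+-identityʳ b) ⟨
  2 * b ≤⟨ 2b≤a ⟩
  a     <⟨ m<m+n a z<s ⟩
  a + 1 <⟨ a+1<b+p ⟩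
  b + p ∎)
  where open ≤-Reasoning

2*b≤a∧a+1<b+p⇒a<p+p : ∀ {a b p} → 2 * b ≤ a → a + 1 < b + p → a < p + p
2*b≤a∧a+1<b+p⇒a<p+p {a} {b} {p} 2b≤a a+1<b+p =
  ≤-<-trans (m≤m+n a 2) (+-cancelˡ-< a (a + 2) (p + p) (begin-strict
    a + (a + 2)       ≡⟨ double-successor a ⟩
    (a + 1) + (a + 1) <⟨ +-mono-< a+1<b+p a+1<b+p ⟩
    (b + p) + (b + p) ≡⟨ regroup b p ⟩
    2 * b + (p + p)   ≤⟨ +-monoˡ-≤ (p + p) 2b≤a ⟩
    a + (p + p)       ∎))
  where
  open ≤-Reasoning
  double-successor : ∀ a → a + (a + 2) ≡ (a + 1) + (a + 1)
  double-successor = solve-∀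
  regroup : ∀ b p → (b + p) + (b + p) ≡ 2 * b + (p + p)
  regroup = solve-∀

mainTheorem5 : (a p b m k : ℕ) → .{{_ : NonZero a}} →
    Prime p → p < a → (∀ q → Prime q → q < a → q ≤ p) →
    2 * b ≤ a → a + 1 < b + p →
    0 < m → 0 < k → N a b ≡ m ^ k →
    k ≤ 2
mainTheorem5 a@(suc n) p zero m k pp p<a _ _ a+1<p _ _ _ =
  contradiction (<-trans (m<m+n a z<s) (<-trans a+1<p p<a)) (<-irrefl refl)
mainTheorem5 a@(suc n) p b@(suc c) m k pp p<a _ 2b≤a a+1<b+p _ _ N≡m^k =
  p∣a*m^k∧p^3∤a*m^k⇒k≤2 m k pp (p<n<p+p⇒p∤n p<a a<p+p)
    (subst (p ∣_) (sym a*m^k≡X) (∣m⇒∣m*n (a C c) (∥⇒∣ p∥aCb)))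
    (λ p^3∣a*m^k → ∥∧∥⇒^3∤* pp p∥aCb p∥aCc (subst (p ^ 3 ∣_) a*m^k≡X p^3∣a*m^k))
  where
  instance _ = prime⇒nonZero pp
  c≤n : c ≤ n
  c≤n = ≤-pred (≤-trans (m≤m+n b (b + 0)) 2b≤a)
  b<p : b < p
  b<p = 2*b≤a∧a+1<b+p⇒b<p {a} {b} {p} 2b≤a a+1<b+p
  a<p+p : a < p + p
  a<p+p = 2*b≤a∧a+1<b+p⇒a<p+p {a} {b} {p} 2b≤a a+1<b+p
  a∸c<p : a ∸ c < p
  a∸c<p = m<n+o⇒m∸n<o a c (subst (_< c + p) (+-comm n 1) (s<s⁻¹ a+1<b+p))
  a∸b<p : a ∸ b < p
  a∸b<p = ≤-<-trans (∸-monoʳ-≤ a (n≤1+n c)) a∸c<p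
  p∥aCb : p ∥ a C b
  p∥aCb = prime∥nCk pp (s≤s c≤n) b<p a∸b<p (<⇒≤ p<a) a<p+p
  p∥aCc : p ∥ a C c
  p∥aCc = prime∥nCk pp (m≤n⇒m≤1+n c≤n) (<-trans (n<1+n c) b<p) a∸c<p (<⇒≤ p<a) a<p+p
  a*m^k≡X : a * m ^ k ≡ (a C b) * (a C c)
  a*m^k≡X = trans (cong (a *_) (sym N≡m^k)) (a*N[a,1+k]≡aC[1+k]*aCk c≤n)
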